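{- Let $(F,O)$ be a MaxSAT instance, $\alpha$ a partial assignment, and $\mathcal{C}$ an $O$-compatible set of weighted local cores of $(F,O)$ relative to $\alpha$. Let $v^*$ be an integer and let $\beta$ be any total assignment that refines $\alpha$ (i.e. $\alpha\subseteq\beta$) and satisfies $F$. (1) If $w(\mathcal{C})\ge v^*$, then $O|_\beta\ge v^*$. (2) If $\ell$ is an objective literal unassigned by $\alpha$ such that $r(\ell,\mathcal{C})+w(\mathcal{C})\ge v^*$, then: if $O|_\beta< v^*$, then $\beta(\ell)=0$.
   Context: All variables are Boolean (values in $\{0,1\}$); a literal is a variable $x$ or its negation $\bar x$ (with $\bar x=1-x$). A (partial) assignment is a (partial) map from variables to $\{0,1\}$, extended to literals, identified with the set of literals it maps to $1$; $\beta$ refines $\alpha$ if $\alpha\subseteq\beta$. A MaxSAT instance is a pair $(F,O)$ where $F$ is a conjunction of clauses and $O=\sum_i c_i b_i$ is an objective to be minimized, with $c_i$ positive integers and $b_i$ pairwise distinct literals (the objective literals); $O|_\beta$ denotes the value of $O$ under $\beta$. For a literal $\ell$, $c(\ell)=c_i$ if $\ell=b_i$ and $c(\ell)=0$ otherwise. A weighted local core of $(F,O)$ relative to $\alpha$ is a triple $\langle w,R,K\rangle$ with $w$ a positive integer, $R\subseteq\alpha$ a set of literals, and $K$ a set consisting only of negations of objective literals, such that $F\wedge R\wedge K\models \bot$ (every assignment satisfying $F$ makes some literal of $R\cup K$ false). A set $\mathcal{C}$ of weighted local cores is $O$-compatible if for each objective literal $\ell$, $\sum_{\langle w,R,K\rangle\in\mathcal{C},\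 \bar\ell\in K} w\le c(\ell)$. The residual weight is $r(\ell,\mathcal{C})=c(\ell)-\sum_{\langle w,R,K\rangle\in\mathcal{C},\ \bar\ell\in K} w$, and $w(\mathcal{C})=\sum_{\langle w,R,K\rangle\in\mathcal{C}} w$. -}

module Defs where

open import Data.Nat using (ℕ; zero; suc; _+_; _*_; _≤_; _<_)
import Data.Nat.Properties as ℕP
open import Data.Integer as ℤ using (ℤ; +_; _-_)
open import Data.Bool using (Bool; true; false; not; if_then_else_)
open import Data.List using (List; []; _∷_; map; _++_)
open import Data.Nat.ListAction using (sum)
open import Data.List.Relation.Unary.All using (All)
open import Data.List.Relation.Unary.Any using (Any; any?)
open import Data.List.Relation.Unary.Unique.Propositional using (Unique)
open import Data.List.Membership.Propositional using (_∈_)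
open import Data.Product using (_×_; _,_; proj₁; proj₂; Σ; ∃)
open import Relation.Nullary using (¬_; Dec; yes; no; does)
open import Relation.Binary.PropositionalEquality using (_≡_; refl; cong)

Var : Set
Var = ℕ

data Lit : Set where
  pos : Var → Lit
  neg : Var → Lit

‾_ : Lit → Lit
‾ pos x = neg x
‾ neg x = pos x

_≟L_ : (a b : Lit) → Dec (a ≡ b)
pos x ≟L pos y with x ℕP.≟ y
... | yes refl = yes refl
... | no x≢y = no λ { refl → x≢y refl }
pos x ≟L neg y = no λ ()
neg x ≟L pos y = no λ ()
neg x ≟L neg y with x ℕP.≟ y
... | yes refl = yes refl
... | no x≢y = no λ { refl → x≢y refl }

Clause : Set
Clause = List Lit

CNF : Set
CNF = List Clause

Objective : Set
Objective = List (ℕ × Lit)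

WellFormedObjective : Objective → Set
WellFormedObjective O = All (λ p → 0 < proj₁ p) O × Unique (map proj₂ O)

Assignment : Set
Assignment = Var → Bool

val : Assignment → Lit → Bool
val β (pos x) = β x
val β (neg x) = not (β x)

True : Assignment → Lit → Set
True β l = val β l ≡ true

Satisfies : Assignment → CNF → Set
Satisfies β F = All (λ C → Any (True β) C) F

-- Partial assignment: identified with the set of literals it maps to 1
PartialAssignment : Set
PartialAssignment = List Lit

Consistent : PartialAssignment → Set
Consistent α = ∀ x → ¬ (pos x ∈ α × neg x ∈ α)

Refines : Assignment → PartialAssignment → Set
Refines β α = All (True β) α

Unassigned : PartialAssignment → Lit → Set
Unassigned α l = ¬ (l ∈ α) × ¬ ((‾ l) ∈ α)

bit : Bool → ℕ
bit true = 1
bit false = 0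

evalObj : Objective → Assignment → ℕ
evalObj O β = sum (map (λ p → proj₁ p * bit (val β (proj₂ p))) O)

IsObjLit : Objective → Lit → Set
IsObjLit O l = l ∈ map proj₂ O

coef : Objective → Lit → ℕ
coef [] l = 0
coef ((c , b) ∷ O) l = (if does (b ≟L l) then c else 0) + coef O l

record WCore : Set where
  constructor ⟨_,_,_⟩
  field
    w : ℕ
    R : List Lit
    K : List Lit
open WCore public

_⊆L_ : List Lit → List Lit → Set
A ⊆L B = All (_∈ B) A

IsWeightedLocalCore : CNF → Objective → PartialAssignment → WCore → Set
IsWeightedLocalCore F O α ⟨ w , R , K ⟩ =
  (0 < w)
  × (R ⊆L α)
  × All (λ k → IsObjLit O (‾ k)) K
  -- F ∧ R ∧ K ⊨ ⊥
  × (∀ (τ : Assignment) → Satisfies τ F → Any (λ l → val τ l ≡ false) (R ++ K))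

usedWeight : List WCore → Lit → ℕ
usedWeight [] l = 0
usedWeight (k ∷ 𝒞) l =
  (if does (any? ((‾ l) ≟L_) (K k)) then w k else 0) + usedWeight 𝒞 l

OCompatible : Objective → List WCore → Set
OCompatible O 𝒞 = ∀ l → IsObjLit O l → usedWeight 𝒞 l ≤ coef O l

residual : Objective → List WCore → Lit → ℤ
residual O 𝒞 l = + coef O l - + usedWeight 𝒞 l

totalWeight : List WCore → ℕ
totalWeight 𝒞 = sum (map w 𝒞)

{-# OPTIONS --safe #-}
-- Let β be a model of F refining α. Every core ⟨w,R,K⟩ is falsified by β, and not on R ⊆ α,
-- so β makes true some objective literal h with h̄ ∈ K. Splitting every coefficient as
-- c(b) = (weight of the cores containing b̄) + r(b, 𝒞), which O-compatibility makes possible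
-- over ℕ, gives O|β ≥ w(𝒞) + Σ_{b true} r(b, 𝒞); both parts follow from this bound.
module Submission where

open import Defs
open import Data.Nat using (ℕ)
open import Data.Integer using (ℤ; +_; _+_; _≤_; _<_)
open import Data.Bool using (false)
open import Data.List using (List)
open import Data.List.Relation.Unary.All using (All)
open import Data.Product using (_×_)
open import Relation.Binary.PropositionalEquality using (_≡_)

open import Data.Bool using (true; not; if_then_else_)
open import Data.Bool.Properties using (not-involutive)
open import Data.Integer using (+≤+)
import Data.Integer.Properties as ℤ
import Data.Nat as Nat
open Nat using (_∸_; _*_; z≤n)
open import Data.Nat.ListAction using (sum)
open import Data.Nat.Properties
  using (+-identityʳ; *-identityʳ; *-distribʳ-+; m+[n∸m]≡n; m≤m+n; m≤n+m; ≤-trans;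
         +-mono-≤; +-monoˡ-≤; +-monoʳ-≤; +-commutativeSemigroup; module ≤-Reasoning)
open import Algebra.Properties.CommutativeSemigroup +-commutativeSemigroup using (interchange)
open import Data.List using ([]; _∷_; map)
open import Data.List.Membership.Propositional using (_∈_; _∉_; find)
open import Data.List.Relation.Unary.All using ([]; _∷_)
import Data.List.Relation.Unary.All as All
open import Data.List.Relation.Unary.All.Properties using (All¬⇒¬Any)
open import Data.List.Relation.Unary.Any using (here; there; any?)
open import Data.List.Relation.Unary.Any.Properties using (++⁻)
open import Data.List.Relation.Unary.AllPairs using (_∷_)
open import Data.List.Relation.Unary.Unique.Propositional using (Unique)
open import Data.Product using (∃; _,_; proj₂)
open import Data.Sum using (inj₁; inj₂)
open import Relation.Nullary using (does; contradiction)
open import Relation.Nullary.Decidable using (dec-true; dec-false)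
open import Relation.Binary.PropositionalEquality
  using (_≢_; refl; sym; trans; cong; cong₂; subst; module ≡-Reasoning)

‾-involutive : ∀ l → ‾ (‾ l) ≡ l
‾-involutive (pos x) = refl
‾-involutive (neg x) = refl

val-‾ : ∀ β l → val β (‾ l) ≡ not (val β l)
val-‾ β (pos x) = refl
val-‾ β (neg x) = sym (not-involutive (β x))

lits : Objective → List Lit
lits O = map proj₂ O

weightOfTrue : Assignment → (Lit → ℕ) → List Lit → ℕ
weightOfTrue β g bs = sum (map (λ b → g b * bit (val β b)) bs)

module _ (β : Assignment) where

  weightOfTrue-cong : ∀ {f g} bs → All (λ b → f b ≡ g b) bs →
                      weightOfTrue β f bs ≡ weightOfTrue β g bs
  weightOfTrue-cong [] [] = refl
  weightOfTrue-cong (b ∷ bs) (f≡g ∷ fs≡gs) =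
    cong₂ Nat._+_ (cong (_* bit (val β b)) f≡g) (weightOfTrue-cong bs fs≡gs)

  weightOfTrue-+ : ∀ f g bs →
    weightOfTrue β (λ b → f b Nat.+ g b) bs ≡ weightOfTrue β f bs Nat.+ weightOfTrue β g bs
  weightOfTrue-+ f g [] = refl
  weightOfTrue-+ f g (b ∷ bs) = begin
    (f b Nat.+ g b) * t Nat.+ weightOfTrue β (λ b → f b Nat.+ g b) bs
      ≡⟨ cong₂ Nat._+_ (*-distribʳ-+ t (f b) (g b)) (weightOfTrue-+ f g bs) ⟩
    (f b * t Nat.+ g b * t) Nat.+ (weightOfTrue β f bs Nat.+ weightOfTrue β g bs)
      ≡⟨ interchange (f b * t) (g b * t) _ _ ⟩
    (f b * t Nat.+ weightOfTrue β f bs) Nat.+ (g b * t Nat.+ weightOfTrue β g bs) ∎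
    where
    open ≡-Reasoning
    t = bit (val β b)

  weightOfTrue-∸ : ∀ f g bs → All (λ b → g b Nat.≤ f b) bs →
    weightOfTrue β f bs ≡ weightOfTrue β g bs Nat.+ weightOfTrue β (λ b → f b ∸ g b) bs
  weightOfTrue-∸ f g bs g≤f =
    trans (weightOfTrue-cong bs (All.map (λ g≤f → sym (m+[n∸m]≡n g≤f)) g≤f))
          (weightOfTrue-+ g (λ b → f b ∸ g b) bs)

  weightOfTrue-≥ : ∀ g {b bs} → b ∈ bs → True β b → g b Nat.≤ weightOfTrue β g bs
  weightOfTrue-≥ g {b} (here refl) b-true
    rewrite b-true | *-identityʳ (g b) = m≤m+n (g b) _
  weightOfTrue-≥ g {bs = b′ ∷ _} (there b∈bs) b-true =
    ≤-trans (weightOfTrue-≥ g b∈bs b-true) (m≤n+m _ (g b′ * bit (val β b′)))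

coef-∉ : ∀ O {l} → l ∉ lits O → coef O l ≡ 0
coef-∉ [] _ = refl
coef-∉ ((c , b) ∷ O) {l} l∉ rewrite dec-false (b ≟L l) (λ { refl → l∉ (here refl) }) =
  coef-∉ O (λ l∈ → l∉ (there l∈))

coef-∷-≢ : ∀ c {b l} O → b ≢ l → coef ((c , b) ∷ O) l ≡ coef O l
coef-∷-≢ c {b} {l} O b≢l rewrite dec-false (b ≟L l) b≢l = refl

coef-∷-head : ∀ c {b} O → b ∉ lits O → coef ((c , b) ∷ O) b ≡ c
coef-∷-head c {b} O b∉ rewrite dec-true (b ≟L b) refl | coef-∉ O b∉ = +-identityʳ c

evalObj≡weightOfTrue-coef : ∀ O β → Unique (lits O) → evalObj O β ≡ weightOfTrue β (coef O) (lits O)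
evalObj≡weightOfTrue-coef [] β _ = refl
evalObj≡weightOfTrue-coef ((c , b) ∷ O) β (b≢O ∷ unique) = cong₂ Nat._+_
  (cong (_* bit (val β b)) (sym (coef-∷-head c O (All¬⇒¬Any b≢O))))
  (trans (evalObj≡weightOfTrue-coef O β unique)
         (sym (weightOfTrue-cong β (lits O) (All.map (coef-∷-≢ c O) b≢O))))

Hit : Assignment → List Lit → WCore → Set
Hit β bs k = ∃ λ h → h ∈ bs × True β h × ‾ h ∈ K k

localCore-hit : ∀ {F O α β} k → IsWeightedLocalCore F O α k →
                Refines β α → Satisfies β F → Hit β (lits O) k
localCore-hit {β = β} ⟨ _ , R , K ⟩ (_ , R⊆α , K-obj , unsat) β⊇α β⊨F
  with ++⁻ R (unsat β β⊨F)
... | inj₁ falseInR with r , r∈R , r-false ← find falseInR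
  with () ← trans (sym (All.lookup β⊇α (All.lookup R⊆α r∈R))) r-false
... | inj₂ falseInK with k , k∈K , k-false ← find falseInK =
  ‾ k , All.lookup K-obj k∈K , trans (val-‾ β k) (cong not k-false) ,
  subst (_∈ K) (sym (‾-involutive k)) k∈K

-- usedWeight (k ∷ 𝒞) l reduces to contribution k l + usedWeight 𝒞 l.
contribution : WCore → Lit → ℕ
contribution k l = if does (any? ((‾ l) ≟L_) (K k)) then w k else 0

contribution-hit : ∀ k {h} → ‾ h ∈ K k → contribution k h ≡ w k
contribution-hit k {h} h̄∈K rewrite dec-true (any? ((‾ h) ≟L_) (K k)) h̄∈K = refl

totalWeight≤weightOfTrue-used : ∀ β bs 𝒞 → All (Hit β bs) 𝒞 →
                                totalWeight 𝒞 Nat.≤ weightOfTrue β (usedWeight 𝒞) bs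
totalWeight≤weightOfTrue-used β bs [] [] = z≤n
totalWeight≤weightOfTrue-used β bs (k ∷ 𝒞) ((h , h∈bs , h-true , h̄∈K) ∷ hits) = begin
  w k Nat.+ totalWeight 𝒞
    ≤⟨ +-mono-≤ w≤ (totalWeight≤weightOfTrue-used β bs 𝒞 hits) ⟩
  weightOfTrue β (contribution k) bs Nat.+ weightOfTrue β (usedWeight 𝒞) bs
    ≡⟨ weightOfTrue-+ β (contribution k) (usedWeight 𝒞) bs ⟨
  weightOfTrue β (usedWeight (k ∷ 𝒞)) bs ∎
  where
  open ≤-Reasoning
  w≤ : w k Nat.≤ weightOfTrue β (contribution k) bs
  w≤ = subst (Nat._≤ _) (contribution-hit k h̄∈K) (weightOfTrue-≥ β (contribution k) h∈bs h-true)

residualWeight : Objective → List WCore → Lit → ℕ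
residualWeight O 𝒞 l = coef O l ∸ usedWeight 𝒞 l

residual≡residualWeight : ∀ O 𝒞 l → usedWeight 𝒞 l Nat.≤ coef O l →
                          residual O 𝒞 l ≡ + residualWeight O 𝒞 l
residual≡residualWeight O 𝒞 l used≤coef =
  trans (ℤ.m-n≡m⊖n (coef O l) (usedWeight 𝒞 l)) (ℤ.⊖-≥ used≤coef)

module _ {F O α β 𝒞} (unique : Unique (lits O)) (compatible : OCompatible O 𝒞)
         (cores : All (IsWeightedLocalCore F O α) 𝒞) (β⊇α : Refines β α) (β⊨F : Satisfies β F) where

  totalWeight+residualWeight≤evalObj :
    totalWeight 𝒞 Nat.+ weightOfTrue β (residualWeight O 𝒞) (lits O) Nat.≤ evalObj O β
  totalWeight+residualWeight≤evalObj = begin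
    totalWeight 𝒞 Nat.+ weightOfTrue β (residualWeight O 𝒞) (lits O)
      ≤⟨ +-monoˡ-≤ _ (totalWeight≤weightOfTrue-used β (lits O) 𝒞 hits) ⟩
    weightOfTrue β (usedWeight 𝒞) (lits O) Nat.+ weightOfTrue β (residualWeight O 𝒞) (lits O)
      ≡⟨ weightOfTrue-∸ β (coef O) (usedWeight 𝒞) (lits O) (All.tabulate (compatible _)) ⟨
    weightOfTrue β (coef O) (lits O)
      ≡⟨ evalObj≡weightOfTrue-coef O β unique ⟨
    evalObj O β ∎
    where
    open ≤-Reasoning
    hits : All (Hit β (lits O)) 𝒞
    hits = All.map (λ {k} core → localCore-hit k core β⊇α β⊨F) cores

  totalWeight≤evalObj : totalWeight 𝒞 Nat.≤ evalObj O β
  totalWeight≤evalObj = ≤-trans (m≤m+n _ _) totalWeight+residualWeight≤evalObj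

  residual+totalWeight≤evalObj : ∀ {l} → IsObjLit O l → True β l →
    residual O 𝒞 l + + totalWeight 𝒞 ≤ + evalObj O β
  residual+totalWeight≤evalObj {l} l∈O l-true = begin
    residual O 𝒞 l + + totalWeight 𝒞
      ≡⟨ cong (_+ + totalWeight 𝒞) (residual≡residualWeight O 𝒞 l (compatible l l∈O)) ⟩
    + residualWeight O 𝒞 l + + totalWeight 𝒞
      ≡⟨ ℤ.+-comm (+ residualWeight O 𝒞 l) (+ totalWeight 𝒞) ⟩
    + totalWeight 𝒞 + + residualWeight O 𝒞 l
      ≡⟨ ℤ.pos-+ (totalWeight 𝒞) (residualWeight O 𝒞 l) ⟨
    + (totalWeight 𝒞 Nat.+ residualWeight O 𝒞 l)
      ≤⟨ +≤+ (+-monoʳ-≤ _ (weightOfTrue-≥ β (residualWeight O 𝒞) l∈O l-true)) ⟩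
    + (totalWeight 𝒞 Nat.+ weightOfTrue β (residualWeight O 𝒞) (lits O))
      ≤⟨ +≤+ totalWeight+residualWeight≤evalObj ⟩
    + evalObj O β ∎
    where open ℤ.≤-Reasoning

proposition1 : (F : CNF) (O : Objective) → WellFormedObjective O →
    (α : PartialAssignment) → Consistent α →
    (𝒞 : List WCore) → All (IsWeightedLocalCore F O α) 𝒞 → OCompatible O 𝒞 →
    (v* : ℤ) (β : Assignment) → Refines β α → Satisfies β F →
    ((v* ≤ + totalWeight 𝒞) → v* ≤ + evalObj O β)
    × ((ℓ : Lit) → IsObjLit O ℓ → Unassigned α ℓ →
    v* ≤ residual O 𝒞 ℓ + + totalWeight 𝒞 →
    + evalObj O β < v* → val β ℓ ≡ false)
proposition1 F O (_ , unique) α _ 𝒞 cores compatible v* β β⊇α β⊨F = lowerBound , forcedFalse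
  where
  lowerBound : v* ≤ + totalWeight 𝒞 → v* ≤ + evalObj O β
  lowerBound v*≤w = ℤ.≤-trans v*≤w (+≤+ (totalWeight≤evalObj unique compatible cores β⊇α β⊨F))

  forcedFalse : (ℓ : Lit) → IsObjLit O ℓ → Unassigned α ℓ →
    v* ≤ residual O 𝒞 ℓ + + totalWeight 𝒞 → + evalObj O β < v* → val β ℓ ≡ false
  forcedFalse ℓ ℓ∈O _ v*≤r+w O<v* with val β ℓ in ℓ-value
  ... | false = refl
  ... | true = contradiction
    (ℤ.≤-trans v*≤r+w (residual+totalWeight≤evalObj unique compatible cores β⊇α β⊨F ℓ∈O ℓ-value))
    (ℤ.<⇒≱ O<v*)
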